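{- Let $\mathbf{q}=(q_1,\dots,q_a)$ be an element of $\prod_{j=1}^a L(v_1,x_j)$. If $s_{q_t}=1$ for some $t\in[a]$, then $q_t\notin L(v_i,x_t)$ for each $i\in\{2,\dots,n\}$.
   Context: Standing setting: $n,a$ are integers with $2\le n\le a$; $M=K_n$ with $V(M)=\{v_1,\dots,v_n\}$; $K_{a,b}$ has partite sets $X=\{x_1,\dots,x_a\}$ and $Y=\{y_1,\dots,y_b\}$ with $b=\left(\prod_{i=0}^{n-1}(n+a-1-i)\right)^a-1$; $H=M\square K_{a,b}$ (Cartesian product). $L$ is an $(n+a-1)$-assignment for $H$ such that for each $i\in[n]$ the lists $L(v_i,x_1),\dots,L(v_i,x_a)$ are pairwise disjoint. $H_X$ is the subgraph of $H$ induced by $\{(v_i,x_j): i\in[n],j\in[a]\}$ (so $(v_i,x_j)\sim(v_{i'},x_{j'})$ in $H_X$ iff $j=j'$ and $i\ne i'$), $L_X$ is the restriction of $L$ to $V(H_X)$, and $\mathcal{C}_X$ is the set of all proper $L_X$-colorings of $H_X$. For each color $q\in\bigcup_{j=1}^a L(v_1,x_j)$, $s_q=1$ if there exists $c\in\mathcal{C}_X$ with $|c^{ -1}(q)|=n$, and $s_q=0$ otherwise. -}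

module Defs where

open import Data.Nat using (ℕ; zero; suc; _+_; _*_; _∸_; _^_; _≤_)
open import Data.Nat.Properties using (_≟_)
open import Data.Fin using (Fin; toℕ)
open import Data.Sum using (_⊎_; inj₁; inj₂)
open import Data.Product using (_×_; _,_; proj₁; proj₂; Σ; ∃)
open import Data.List using (List; length; filter; map; upTo; allFin; cartesianProduct)
open import Data.Nat.ListAction using (product)
open import Data.List.Membership.Propositional using (_∈_; _∉_)
open import Data.List.Relation.Unary.Unique.Propositional using (Unique)
open import Relation.Binary.PropositionalEquality using (_≡_; _≢_)

Color : Set
Color = ℕ

bSize : ℕ → ℕ → ℕ
bSize n a = product (map (λ i → n + a ∸ 1 ∸ i) (upTo n)) ^ a ∸ 1

-- Vertices of K_{a,b}: X = Fin a (inj₁), Y = Fin b (inj₂).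
-- Vertices of H = K_n □ K_{a,b}: pairs (v_i , w).
VH : ℕ → ℕ → ℕ → Set
VH n a b = Fin n × (Fin a ⊎ Fin b)

ListAssignment : ℕ → ℕ → ℕ → Set
ListAssignment n a b = VH n a b → List Color

IsKAssignment : ∀ {n a b} → ℕ → ListAssignment n a b → Set
IsKAssignment k L = ∀ v → Unique (L v) × length (L v) ≡ k

RowDisjoint : ∀ {n a b} → ListAssignment n a b → Set
RowDisjoint {n} {a} L =
  (i : Fin n) (j j′ : Fin a) → j ≢ j′ →
  (c : Color) → c ∈ L (i , inj₁ j) → c ∉ L (i , inj₁ j′)

-- Colorings of H_X (vertex (v_i,x_j) ↦ c i j).
ColoringX : ℕ → ℕ → Set
ColoringX n a = Fin n → Fin a → Color

-- Proper L_X-coloring of H_X: (v_i,x_j) ~ (v_i',x_j') iff j = j' and i ≠ i'.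
IsProperLXColoring : ∀ {n a b} → ListAssignment n a b → ColoringX n a → Set
IsProperLXColoring {n} {a} L c =
  ((i : Fin n) (j : Fin a) → c i j ∈ L (i , inj₁ j)) ×
  ((i i′ : Fin n) (j : Fin a) → i ≢ i′ → c i j ≢ c i′ j)

preimageSize : ∀ {n a} → ColoringX n a → Color → ℕ
preimageSize {n} {a} c q =
  length (filter (λ v → c (proj₁ v) (proj₂ v) ≟ q) (cartesianProduct (allFin n) (allFin a)))

SqIsOne : ∀ {n a b} → ListAssignment n a b → Color → Set
SqIsOne {n} {a} L q = Σ (ColoringX n a) λ c → IsProperLXColoring L c × preimageSize c q ≡ n

v₁ : (n : ℕ) → 2 ≤ n → Fin n
v₁ (suc n) _ = Fin.zero

{-# OPTIONS --safe #-}
-- In a proper L_X-colouring c of H_X, the lists of a row being pairwise disjoint forces c to use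
-- each colour at most once per row, so a colour class of size n meets every row; and a colour
-- lying in L(v_i, x_t) can appear in row i only in column t.  Thus if s_{q_t} = 1 and
-- q_t ∈ L(v_i, x_t) for some i ≥ 2, the colour class of q_t contains both (v_1, x_t) and
-- (v_i, x_t), which are adjacent.  The list sizes, n ≤ a and the value of b play no role.
module Submission where

open import Defs
open import Data.Nat using (ℕ; suc; _+_; _∸_; _≤_; _<_; z≤n; s≤s)
open import Data.Nat.ListAction using (sum)
open import Data.Nat.Properties using (_≟_; ≤-reflexive; +-mono-≤; +-mono-≤-<; <-irrefl)
open import Data.Fin using (Fin; toℕ)
import Data.Fin.Properties as Fin
open import Data.Sum using (inj₁)
open import Data.Product using (_×_; _,_; ∃; proj₁; proj₂)
open import Data.List using (List; []; _∷_; _++_; length; filter; map; allFin; cartesianProduct)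
open import Data.List.Properties using (length-++; filter-++; filter-none; length-tabulate)
open import Data.List.Membership.Propositional using (_∈_; _∉_)
open import Data.List.Membership.Propositional.Properties using (∈-allFin)
open import Data.List.Relation.Unary.Any using (here; there)
open import Data.List.Relation.Unary.All as All using (All)
open import Data.List.Relation.Unary.AllPairs using (_∷_)
open import Data.List.Relation.Unary.Unique.Propositional using (Unique)
open import Data.List.Relation.Unary.Unique.Propositional.Properties using (allFin⁺)
open import Function using (id)
open import Level using (Level)
open import Relation.Binary.PropositionalEquality
  using (_≡_; _≢_; refl; sym; trans; cong; cong₂; subst; subst₂; module ≡-Reasoning)
open import Relation.Nullary using (¬_; yes; no)
open import Relation.Nullary.Decidable using (decidable-stable)
open import Relation.Unary using (Pred; Decidable)

module _ {A : Set} {p : Level} {P : Pred A p} (P? : Decidable P) where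

  length-filter-map : ∀ {B : Set} (f : B → A) (xs : List B) →
                      length (filter P? (map f xs)) ≡ length (filter (λ x → P? (f x)) xs)
  length-filter-map f []       = refl
  length-filter-map f (x ∷ xs) with P? (f x)
  ... | yes _ = cong suc (length-filter-map f xs)
  ... | no  _ = length-filter-map f xs

  length-filter≤1 : ∀ {xs} → Unique xs → (∀ {x y} → P x → P y → x ≡ y) →
                    length (filter P? xs) ≤ 1
  length-filter≤1 {[]}     _          _        = z≤n
  length-filter≤1 {x ∷ xs} (x∉ ∷ xs!) P-unique with P? x
  ... | yes Px = s≤s (≤-reflexive (cong length (filter-none P? ¬P-rest)))
    where
    ¬P-rest : All (λ y → ¬ P y) xs
    ¬P-rest = All.map (λ x≢y Py → x≢y (P-unique Px Py)) x∉
  ... | no  _  = length-filter≤1 xs! P-unique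

length-filter-cartesianProduct :
  ∀ {A B : Set} {p : Level} {P : Pred (A × B) p} (P? : Decidable P) (xs : List A) (ys : List B) →
  length (filter P? (cartesianProduct xs ys))
    ≡ sum (map (λ x → length (filter (λ y → P? (x , y)) ys)) xs)
length-filter-cartesianProduct P? []       ys = refl
length-filter-cartesianProduct P? (x ∷ xs) ys = begin
  length (filter P? (map (x ,_) ys ++ cartesianProduct xs ys))
    ≡⟨ cong length (filter-++ P? (map (x ,_) ys) _) ⟩
  length (filter P? (map (x ,_) ys) ++ filter P? (cartesianProduct xs ys))
    ≡⟨ length-++ (filter P? (map (x ,_) ys)) ⟩
  length (filter P? (map (x ,_) ys)) + length (filter P? (cartesianProduct xs ys))
    ≡⟨ cong₂ _+_ (length-filter-map P? (x ,_) ys) (length-filter-cartesianProduct P? xs ys) ⟩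
  length (filter (λ y → P? (x , y)) ys) + sum (map (λ x → length (filter (λ y → P? (x , y)) ys)) xs)
    ∎
  where open ≡-Reasoning

sum-map≤length : ∀ {A : Set} (f : A → ℕ) → (∀ x → f x ≤ 1) → ∀ xs → sum (map f xs) ≤ length xs
sum-map≤length f f≤1 []       = z≤n
sum-map≤length f f≤1 (x ∷ xs) = +-mono-≤ (f≤1 x) (sum-map≤length f f≤1 xs)

sum-map<length : ∀ {A : Set} (f : A → ℕ) → (∀ x → f x ≤ 1) →
                 ∀ {x₀ xs} → x₀ ∈ xs → f x₀ ≡ 0 → sum (map f xs) < length xs
sum-map<length f f≤1 {xs = x ∷ xs} (here refl) fx≡0 rewrite fx≡0 = s≤s (sum-map≤length f f≤1 xs)
sum-map<length f f≤1 {xs = x ∷ xs} (there x₀∈) fx₀≡0 =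
  +-mono-≤-< (f≤1 x) (sum-map<length f f≤1 x₀∈ fx₀≡0)

rowCount : ∀ {n a} → ColoringX n a → Color → Fin n → ℕ
rowCount {a = a} c q i = length (filter (λ j → c i j ≟ q) (allFin a))

preimageSize≡sum-rowCount : ∀ {n a} (c : ColoringX n a) (q : Color) →
                            preimageSize c q ≡ sum (map (rowCount c q) (allFin n))
preimageSize≡sum-rowCount {n} {a} c q =
  length-filter-cartesianProduct (λ v → c (proj₁ v) (proj₂ v) ≟ q) (allFin n) (allFin a)

rowCount-absent : ∀ {n a} (c : ColoringX n a) (q : Color) (i : Fin n) →
                  ¬ (∃ λ j → c i j ≡ q) → rowCount c q i ≡ 0
rowCount-absent {a = a} c q i ¬meets =
  cong length (filter-none (λ j → c i j ≟ q) (All.universal (λ j cij≡q → ¬meets (j , cij≡q)) (allFin a)))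

module ProperColouring {n a b} {L : ListAssignment n a b} (disjoint : RowDisjoint L)
                       {c : ColoringX n a} (c-proper : IsProperLXColoring L c) where

  colour-column : ∀ {i j t q} → q ∈ L (i , inj₁ t) → c i j ≡ q → j ≡ t
  colour-column {i} {j} {t} {q} q∈ cij≡q = decidable-stable (j Fin.≟ t) λ j≢t →
    disjoint i j t j≢t q (subst (_∈ L (i , inj₁ j)) cij≡q (proj₁ c-proper i j)) q∈

  rowCount≤1 : ∀ q i → rowCount c q i ≤ 1
  rowCount≤1 q i = length-filter≤1 (λ j → c i j ≟ q) (allFin⁺ a)
    λ {j} {j′} cij≡q cij′≡q → colour-column (proj₁ c-proper i j′) (trans cij≡q (sym cij′≡q))

  colourClass-meets-row : ∀ {q} → preimageSize c q ≡ n → ∀ i → ∃ λ j → c i j ≡ q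
  colourClass-meets-row {q} size≡n i =
    decidable-stable (Fin.any? λ j → c i j ≟ q) λ ¬meets → <-irrefl size≡n (preimageSize<n ¬meets)
    where
    preimageSize<n : ¬ (∃ λ j → c i j ≡ q) → preimageSize c q < n
    preimageSize<n ¬meets = subst₂ _<_ (sym (preimageSize≡sum-rowCount c q)) (length-tabulate id)
      (sum-map<length (rowCount c q) (rowCount≤1 q) (∈-allFin i) (rowCount-absent c q i ¬meets))

  colourClass-at-column : ∀ {q i t} → preimageSize c q ≡ n → q ∈ L (i , inj₁ t) → c i t ≡ q
  colourClass-at-column size≡n q∈ with colourClass-meets-row size≡n _
  ... | j , cij≡q with refl ← colour-column q∈ cij≡q = cij≡q

v₁≢ : ∀ {n} (2≤n : 2 ≤ n) (i : Fin n) → 1 ≤ toℕ i → v₁ n 2≤n ≢ i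
v₁≢ {suc _} _ _ () refl

lemma16 : (n a : ℕ) (2≤n : 2 ≤ n) (n≤a : n ≤ a)
          (L : ListAssignment n a (bSize n a)) →
          IsKAssignment (n + a ∸ 1) L →
          RowDisjoint L →
          (q : Fin a → Color) →
          ((j : Fin a) → q j ∈ L (v₁ n 2≤n , inj₁ j)) →
          (t : Fin a) → SqIsOne L (q t) →
          (i : Fin n) → 1 ≤ toℕ i → q t ∉ L (i , inj₁ t)
lemma16 n a 2≤n _ L _ disjoint q q∈L₁ t (c , c-proper , size≡n) i 1≤i qt∈Lᵢ =
  proj₂ c-proper (v₁ n 2≤n) i t (v₁≢ 2≤n i 1≤i)
    (trans (colourClass-at-column size≡n (q∈L₁ t)) (sym (colourClass-at-column size≡n qt∈Lᵢ)))
  where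
  open ProperColouring {L = L} disjoint c-proper
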